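{- Let $(P_z)_{z\in C(I)}$ be a $k$-flower on index set $I$. Then $P_v\cap P_w=\emptyset$ for all distinct $v,w\in C(I)\setminus I$.
   Context: Universe: $V$ is a set and $\mathcal{U}$ is a set of pairs $(A,B)$ with $A\cup B=V$ (called separations), closed under $(A,B)\wedge(C,D)=(A\cap C,B\cup D)$, $(A,B)\vee(C,D)=(A\cup C,B\cap D)$ and $(A,B)^*=(B,A)$. The order of $(A,B)$ is $|A\cap B|$ (or $\infty$). $k\in\mathbb{N}$. Cyclic orders: a cyclic order on $S$ is a set $Z\subseteq S^3$ with: $(a,b,c)\in Z\Rightarrow(b,c,a)\in Z$; $(a,b,c)\in Z\Rightarrow(c,b,a)\notin Z$; for pairwise distinct $a,b,c$, $(a,b,c)\notin Z\Rightarrow (c,b,a)\in Z$; $(a,b,c),(a,c,d)\in Z\Rightarrow(a,b,d)\in Z$. Write $]a,b[=\{c:(a,c,b)\in Z\}$, $[a,b]=]a,b[\cup\{a,b\}$. A subset $J$ is an interval if for all $s,t\in J$, $[s,t]\subseteq J$ or $[t,s]\subseteq J$; non-trivial if neither empty nor everything. For a cyclically ordered set $I$ with $|I|\ge2$, its cycle completion $C(I)$ is a cyclically ordered set containing $I$ (inducing the given order on $I$) such that every non-trivial interval of $I$ can be written uniquely as $[v,w]\cap I$ with $v,w\in C(I)\setminus I$. Every $i\in I$ has a predecessor $p(i)$ and successor $s(i)$ in $C(I)$. $k$-pseudoflowers: for $I$ cyclically ordered with $|I|\ge2$ and a family $(P_z)_{z\in C(I)}$ of subsets of $V$, put $X=V\setminus\bigcup_z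 P_z$, $V(v,w)=X\cup\bigcup_{z\in[v,w]}P_z$ for $v,w\in C(I)\setminus I$, and $S(v,w)=(V(v,w),V(w,v))$ for $v\neq w$. The family is a $k$-pseudoflower on index set $I$ if (i) $|P_v|=(k-|X|)/2$ for all $v\in C(I)\setminus I$; (ii) for distinct $v,w\in C(I)\setminus I$, $S(v,w)\in\mathcal{U}$ has order at most $k$ and $V(v,w)\cap V(w,v)=P_v\cup P_w\cup X$; (iii) $P_{p(i)}\cup P_{s(i)}\subseteq P_i$ for all $i\in I$; (iv) for $i,i'\in I$, if $|P_i|=(k-|X|)/2$ and $P_i=P_{i'}$ then $i=i'$. A $k$-flower is a $k$-pseudoflower in which every $S(v,w)$ (distinct $v,w\in C(I)\setminus I$) has order exactly $k$ and both $V(v,w)\setminus V(w,v)$ and $V(w,v)\setminus V(v,w)$ are non-empty. -}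

module Defs where

open import Data.Nat using (ℕ; _+_; _*_; _≤_)
open import Data.Fin using (Fin)
open import Data.Product using (Σ; _×_; _,_)
open import Data.Sum using (_⊎_)
open import Data.Empty using (⊥)
open import Relation.Nullary using (¬_)
open import Relation.Binary.PropositionalEquality using (_≡_; _≢_)

Subset : Set → Set₁
Subset V = V → Set

infixr 7 _∩_
infixr 6 _∪_

_∩_ : {V : Set} → Subset V → Subset V → Subset V
(A ∩ B) x = A x × B x

_∪_ : {V : Set} → Subset V → Subset V → Subset V
(A ∪ B) x = A x ⊎ B x

_≐_ : {V : Set} → Subset V → Subset V → Set
A ≐ B = ∀ x → (A x → B x) × (B x → A x)

HasSize : {V : Set} → Subset V → ℕ → Set
HasSize {V} A n =
  Σ (Fin n → V) λ f →
    (∀ i j → f i ≡ f j → i ≡ j) ×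
    (∀ i → A (f i)) ×
    (∀ x → A x → Σ (Fin n) λ i → f i ≡ x)

record Universe (V : Set) : Set₁ where
  field
    𝒰        : Subset V → Subset V → Set
    covers   : ∀ {A B} → 𝒰 A B → ∀ x → (A ∪ B) x
    closed-∧ : ∀ {A B C D} → 𝒰 A B → 𝒰 C D → 𝒰 (A ∩ C) (B ∪ D)
    closed-∨ : ∀ {A B C D} → 𝒰 A B → 𝒰 C D → 𝒰 (A ∪ C) (B ∩ D)
    closed-* : ∀ {A B} → 𝒰 A B → 𝒰 B A
    -- separations are pairs of *sets*: membership respects set equality
    extensional : ∀ {A A' B B'} → A ≐ A' → B ≐ B' → 𝒰 A B → 𝒰 A' B'

OrderAtMost : {V : Set} → ℕ → Subset V → Subset V → Set
OrderAtMost k A B = Σ ℕ λ n → n ≤ k × HasSize (A ∩ B) n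

OrderExactly : {V : Set} → ℕ → Subset V → Subset V → Set
OrderExactly k A B = HasSize (A ∩ B) k

record IsCyclicOrder {S : Set} (Z : S → S → S → Set) : Set where
  field
    cyc   : ∀ {a b c} → Z a b c → Z b c a
    asym  : ∀ {a b c} → Z a b c → ¬ Z c b a
    total : ∀ {a b c} → a ≢ b → b ≢ c → a ≢ c → ¬ Z a b c → Z c b a
    trans : ∀ {a b c d} → Z a b c → Z a c d → Z a b d

OpenI : {S : Set} → (S → S → S → Set) → S → S → Subset S
OpenI Z a b c = Z a c b

ClosedI : {S : Set} → (S → S → S → Set) → S → S → Subset S
ClosedI Z a b c = OpenI Z a b c ⊎ (c ≡ a ⊎ c ≡ b)

-- Cycle completion.  C carries the cyclic order Z; the index set I is the
-- subset inI of C, with the cyclic order induced by Z.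

module _ {C : Set} (Z : C → C → C → Set) (inI : Subset C) where

  -- J is an interval of I (w.r.t. the induced order; [s,t] in I is [s,t] ∩ I)
  IsIntervalOfI : Subset C → Set
  IsIntervalOfI J =
    (∀ c → J c → inI c) ×
    (∀ s t → J s → J t →
       (∀ c → inI c → ClosedI Z s t c → J c) ⊎
       (∀ c → inI c → ClosedI Z t s c → J c))

  NonTrivialI : Subset C → Set
  NonTrivialI J = (Σ C λ c → J c) × (Σ C λ c → inI c × ¬ J c)

  Represents : Subset C → C → C → Set
  Represents J v w = J ≐ (ClosedI Z v w ∩ inI)

  record IsCycleCompletion : Set₁ where
    field
      cyclicOrder : IsCyclicOrder Z
      atLeastTwo  : Σ C λ i → Σ C λ j → inI i × inI j × i ≢ j
      represent   : ∀ J → IsIntervalOfI J → NonTrivialI J →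
        Σ C λ v → Σ C λ w → ¬ inI v × ¬ inI w × Represents J v w ×
          (∀ v' w' → ¬ inI v' → ¬ inI w' → Represents J v' w' →
             v' ≡ v × w' ≡ w)

  IsPredecessor : C → C → Set
  IsPredecessor p i = p ≢ i × (∀ c → ¬ OpenI Z p i c)

  IsSuccessor : C → C → Set
  IsSuccessor i s = i ≢ s × (∀ c → ¬ OpenI Z i s c)

module _ {V : Set} (U : Universe V) (k : ℕ)
         {C : Set} (Z : C → C → C → Set) (inI : Subset C)
         (P : C → Subset V) where

  open Universe U

  Xset : Subset V
  Xset x = ¬ (Σ C λ z → P z x)

  Vset : C → C → Subset V
  Vset v w x = Xset x ⊎ (Σ C λ z → ClosedI Z v w z × P z x)

  -- |A| = (k - |X|)/2, i.e. A and X are finite with 2|A| + |X| = k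
  HalfSize : Subset V → Set
  HalfSize A = Σ ℕ λ a → Σ ℕ λ b → HasSize A a × HasSize Xset b × 2 * a + b ≡ k

  record IsPseudoflower : Set where
    field
      cond-i   : ∀ v → ¬ inI v → HalfSize (P v)
      cond-ii  : ∀ v w → ¬ inI v → ¬ inI w → v ≢ w →
        𝒰 (Vset v w) (Vset w v) ×
        OrderAtMost k (Vset v w) (Vset w v) ×
        ((Vset v w ∩ Vset w v) ≐ (P v ∪ P w ∪ Xset))
      cond-iii : ∀ i p s → inI i → IsPredecessor Z inI p i → IsSuccessor Z inI i s →
        ∀ x → (P p ∪ P s) x → P i x
      cond-iv  : ∀ i i' → inI i → inI i' → HalfSize (P i) → P i ≐ P i' → i ≡ i'

  record IsFlower : Set where
    field
      pseudoflower : IsPseudoflower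
      exactOrder   : ∀ v w → ¬ inI v → ¬ inI w → v ≢ w →
        OrderExactly k (Vset v w) (Vset w v)
      leftNonEmpty  : ∀ v w → ¬ inI v → ¬ inI w → v ≢ w →
        Σ V λ x → Vset v w x × ¬ Vset w v x
      rightNonEmpty : ∀ v w → ¬ inI v → ¬ inI w → v ≢ w →
        Σ V λ x → Vset w v x × ¬ Vset v w x

-- The separator of S(v,w) is P_v ∪ P_w ∪ X and has exactly k elements, while
-- |P_v| + |P_w| + |X| = 2(k - |X|)/2 + |X| = k. Listing P_v, P_w and X one after
-- the other therefore gives k entries covering a k-element set, so no element is
-- listed twice; an element of P_v ∩ P_w would be.
module Submission where

open import Defs
open import Data.Nat using (ℕ; suc; _+_; _*_)
open import Data.Nat.Properties using (+-cancelʳ-≡; *-cancelˡ-≡; +-assoc; +-identityʳ; 1+n≰n)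
open import Data.Fin using (Fin; splitAt; _↑ˡ_; _↑ʳ_; punchOut; _≟_)
open import Data.Fin.Properties
  using (splitAt-↑ˡ; splitAt-↑ʳ; punchOut-injective; injective⇒≤; cantor-schröder-bernstein; any?)
open import Data.Vec.Functional using (_++_)
open import Data.Vec.Functional.Properties using (lookup-++ˡ; lookup-++ʳ)
open import Data.Product using (Σ; ∃; _×_; _,_; proj₁; proj₂)
open import Data.Sum using (inj₁; inj₂)
open import Data.Empty using (⊥)
open import Function.Definitions using (Injective)
open import Relation.Nullary using (¬_; yes; no; contradiction)
open import Relation.Unary using (_⊆_)
open import Relation.Binary.PropositionalEquality
  using (_≡_; _≢_; refl; sym; trans; cong; subst; module ≡-Reasoning)

private
  variable
    m n : ℕ
    V : Set

injective⇒surjective : {f : Fin n → Fin n} → Injective _≡_ _≡_ f →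
  ∀ t → ∃ λ j → f j ≡ t
injective⇒surjective {n = suc _} {f = f} f-inj t with any? (λ j → f j ≟ t)
... | yes hit = hit
... | no miss = contradiction (injective⇒≤ punched-inj) 1+n≰n
  where
  f≢t : ∀ j → t ≢ f j
  f≢t j t≡fj = miss (j , sym t≡fj)
  punched-inj : Injective _≡_ _≡_ (λ j → punchOut (f≢t j))
  punched-inj {i} {j} eq = f-inj (punchOut-injective (f≢t i) (f≢t j) eq)

↑ˡ≢↑ʳ : (i : Fin m) (j : Fin n) → i ↑ˡ n ≢ m ↑ʳ j
↑ˡ≢↑ʳ {m} {n} i j eq
  with trans (sym (splitAt-↑ˡ m i n)) (trans (cong (splitAt m) eq) (splitAt-↑ʳ m n j))
... | ()

Covers : (Fin n → V) → Subset V → Set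
Covers f A = ∀ x → A x → ∃ λ i → f i ≡ x

HasSize-covers : {A : Subset V} ((f , _) : HasSize A n) → Covers f A
HasSize-covers (_ , _ , _ , onto) = onto

HasSize-reindex : {A : Subset V} ((g , _) : HasSize A m) (h : Fin n → V) → Covers h A →
  Σ (Fin m → Fin n) λ F → Injective _≡_ _≡_ F × (∀ j → h (F j) ≡ g j)
HasSize-reindex (g , g-inj , g∈A , _) h h-covers = F , F-inj , hF≡g
  where
  F : Fin _ → Fin _
  F j = proj₁ (h-covers (g j) (g∈A j))
  hF≡g : ∀ j → h (F j) ≡ g j
  hF≡g j = proj₂ (h-covers (g j) (g∈A j))
  F-inj : Injective _≡_ _≡_ F
  F-inj {i} {j} eq = g-inj i j (trans (sym (hF≡g i)) (trans (cong h eq) (hF≡g j)))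

HasSize-unique : {A : Subset V} → HasSize A m → HasSize A n → m ≡ n
HasSize-unique A∣m A∣n@(f , _) with HasSize-reindex A∣m f (HasSize-covers A∣n)
... | _ , F-inj , _ with HasSize-reindex A∣n (proj₁ A∣m) (HasSize-covers A∣m)
...   | _ , G-inj , _ = cantor-schröder-bernstein F-inj G-inj

-- Reindexing the enumeration of A through h gives an injection Fin n → Fin n, hence
-- a bijection, so h agrees with the (injective) enumeration up to a permutation.
covers-size⇒injective : {A : Subset V} → HasSize A n → (h : Fin n → V) → Covers h A →
  Injective _≡_ _≡_ h
covers-size⇒injective A∣n@(g , g-inj , _) h h-covers {i} {j} hi≡hj
  with HasSize-reindex A∣n h h-covers
... | F , F-inj , hF≡g with injective⇒surjective F-inj i | injective⇒surjective F-inj j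
...   | i′ , refl | j′ , refl = cong F (g-inj i′ j′ gi′≡gj′)
  where
  gi′≡gj′ : g i′ ≡ g j′
  gi′≡gj′ = trans (sym (hF≡g i′)) (trans hi≡hj (hF≡g j′))

++-covers-∪ : {A B : Subset V} {f : Fin m → V} {g : Fin n → V} →
  Covers f A → Covers g B → Covers (f ++ g) (A ∪ B)
++-covers-∪ {n = n} {f = f} {g} f-covers g-covers x (inj₁ x∈A) with f-covers x x∈A
... | i , fi≡x = i ↑ˡ n , trans (lookup-++ˡ f g i) fi≡x
++-covers-∪ {m = m} {f = f} {g} f-covers g-covers x (inj₂ x∈B) with g-covers x x∈B
... | j , gj≡x = m ↑ʳ j , trans (lookup-++ʳ f g j) gj≡x

tight-cover⇒disjoint : {A B S : Subset V} {f : Fin m → V} {g : Fin n → V} →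
  Covers f A → Covers g B → HasSize S (m + n) → S ⊆ (A ∪ B) →
  ∀ x → A x → B x → ⊥
tight-cover⇒disjoint {m = m} {n = n} {f = f} {g} f-covers g-covers S∣m+n S⊆A∪B x x∈A x∈B
  with f-covers x x∈A | g-covers x x∈B
... | i , fi≡x | j , gj≡x = ↑ˡ≢↑ʳ i j (fg-inj (begin
    (f ++ g) (i ↑ˡ n)  ≡⟨ lookup-++ˡ f g i ⟩
    f i                ≡⟨ trans fi≡x (sym gj≡x) ⟩
    g j                ≡⟨ lookup-++ʳ f g j ⟨
    (f ++ g) (m ↑ʳ j)  ∎))
  where
  open ≡-Reasoning
  fg-inj : Injective _≡_ _≡_ (f ++ g)
  fg-inj = covers-size⇒injective S∣m+n (f ++ g)
    (λ y y∈S → ++-covers-∪ f-covers g-covers y (S⊆A∪B y∈S))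

twice-plus-cancel : ∀ a a′ {b k} → 2 * a + b ≡ k → 2 * a′ + b ≡ k → a ≡ a′
twice-plus-cancel a a′ {b} eq eq′ = *-cancelˡ-≡ a a′ 2 (+-cancelʳ-≡ b _ _ (trans eq (sym eq′)))

twice-plus : ∀ a b → 2 * a + b ≡ a + (a + b)
twice-plus a b = trans (cong (λ z → a + z + b) (+-identityʳ a)) (+-assoc a a b)

module _ {V : Set} (U : Universe V) (k : ℕ) {C : Set} (Z : C → C → C → Set)
         (inI : Subset C) (P : C → Subset V) where

  HalfSize-agree : {A B : Subset V} → HalfSize U k Z inI P A → HalfSize U k Z inI P B →
    Σ ℕ λ a → Σ ℕ λ b →
      HasSize A a × HasSize B a × HasSize (Xset U k Z inI P) b × a + (a + b) ≡ k
  HalfSize-agree (a , b , A∣a , X∣b , 2a+b≡k) (a′ , b′ , B∣a′ , X∣b′ , 2a′+b′≡k)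
    with HasSize-unique X∣b′ X∣b
  ... | refl with twice-plus-cancel a′ a 2a′+b′≡k 2a+b≡k
  ... | refl = a , b , A∣a , B∣a′ , X∣b , trans (sym (twice-plus a b)) 2a+b≡k

open IsFlower using (pseudoflower; exactOrder)
open IsPseudoflower using (cond-i; cond-ii)

lemma3p5 : {V : Set} (U : Universe V) (k : ℕ)
    {C : Set} (Z : C → C → C → Set) (inI : Subset C) →
    IsCycleCompletion Z inI →
    (P : C → Subset V) → IsFlower U k Z inI P →
    ∀ v w → ¬ inI v → ¬ inI w → v ≢ w →
    ∀ x → P v x → P w x → ⊥
lemma3p5 U k Z inI _ P flower v w v∉I w∉I v≢w x x∈Pv x∈Pw
  with HalfSize-agree U k Z inI P (cond-i (pseudoflower flower) v v∉I)
                                  (cond-i (pseudoflower flower) w w∉I)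
... | a , b , Pv∣a , Pw∣a , X∣b , a+a+b≡k =
  tight-cover⇒disjoint (HasSize-covers Pv∣a)
    (++-covers-∪ (HasSize-covers Pw∣a) (HasSize-covers X∣b))
    (subst (HasSize (Vset U k Z inI P v w ∩ Vset U k Z inI P w v))
       (sym a+a+b≡k) (exactOrder flower v w v∉I w∉I v≢w))
    (λ {y} → proj₁ (proj₂ (proj₂ (cond-ii (pseudoflower flower) v w v∉I w∉I v≢w)) y))
    x x∈Pv (inj₁ x∈Pw)
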